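{- Let $S$ be a finite commutative semigroup and $g_1,\dots,g_t\in S$ (not necessarily distinct). For any subset $I\subseteq[1,t]$, $$\sum_{i\in I}g_i+\sum_{j\in[1,t]\setminus I}e(g_j)\ \preceq_{\mathcal H}\ \sum_{i=1}^tg_i.$$
   Context: $S$ is written additively; $e(x)$ is the unique idempotent in $\langle x\rangle=\{mx:m\ge1\}$. $(a)=\{a\}\cup(a+S)$, and $a\preceq_{\mathcal H}b$ iff $(a)\subseteq(b)$. An empty sum is simply omitted from the expression. -}

module Defs where

open import Level using (Level; _⊔_)
open import Algebra.Bundles using (CommutativeSemigroup)
open import Data.Nat using (ℕ; zero; suc)
open import Data.Fin using (Fin)
open import Data.Fin.Subset using (Subset; _∈_; _∉_)
open import Data.Fin.Subset.Properties using (_∈?_)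
open import Data.List using (List; []; _∷_; map; filter; allFin)
open import Data.Maybe using (Maybe; just; nothing)
open import Data.Product using (Σ; ∃; _,_)
open import Data.Sum using (_⊎_)
open import Relation.Nullary using (¬?)
open import Function using (_∘_)

module _ {c ℓ : Level} (S : CommutativeSemigroup c ℓ) where
  open CommutativeSemigroup S renaming (_∙_ to _+_)

  IsFinite : Set (c ⊔ ℓ)
  IsFinite = Σ ℕ λ n → Σ (Fin n → Carrier) λ f → ∀ x → ∃ λ i → f i ≈ x

  -- mult m x  =  (m+1) x   (positive multiples only; S need not have a zero)
  mult : ℕ → Carrier → Carrier
  mult zero    x = x
  mult (suc m) x = x + mult m x

  _∈⟨_⟩ : Carrier → Carrier → Set ℓ
  y ∈⟨ x ⟩ = ∃ λ m → y ≈ mult m x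

  IsIdempotent : Carrier → Set ℓ
  IsIdempotent y = y + y ≈ y

  -- e is the idempotent map: e x is an idempotent of ⟨x⟩
  -- (in a finite semigroup this idempotent exists and is unique, so e is determined).
  IsIdempotentMap : (Carrier → Carrier) → Set (c ⊔ ℓ)
  IsIdempotentMap e = ∀ x → IsIdempotent (e x) × (e x) ∈⟨ x ⟩
    where open import Data.Product using (_×_)

  _∈principal_ : Carrier → Carrier → Set (c ⊔ ℓ)
  z ∈principal a = z ≈ a ⊎ ∃ λ s → z ≈ a + s

  _≼H_ : Carrier → Carrier → Set (c ⊔ ℓ)
  a ≼H b = ∀ z → z ∈principal a → z ∈principal b

  sum⁺ : List Carrier → Maybe Carrier
  sum⁺ []       = nothing
  sum⁺ (x ∷ xs) with sum⁺ xs
  ... | nothing = just x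
  ... | just s  = just (x + s)

  _⊕_ : Maybe Carrier → Maybe Carrier → Maybe Carrier
  nothing ⊕ b       = b
  just a  ⊕ nothing = just a
  just a  ⊕ just b  = just (a + b)

  sumOver : {t : ℕ} → Subset t → (Fin t → Carrier) → Maybe Carrier
  sumOver {t} I f = sum⁺ (map f (filter (_∈? I) (allFin t)))

  sumOverCompl : {t : ℕ} → Subset t → (Fin t → Carrier) → Maybe Carrier
  sumOverCompl {t} I f = sum⁺ (map f (filter (λ j → ¬? (j ∈? I)) (allFin t)))

  sumAll : {t : ℕ} → (Fin t → Carrier) → Maybe Carrier
  sumAll {t} f = sum⁺ (map f (allFin t))

{-# OPTIONS --safe #-}
-- An idempotent e ∈ ⟨x⟩ is a multiple (m+1)x, so e = e + e = x + (m x + e) lies in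
-- the principal ideal (x).  Since x ∈ (y) is compatible with addition, replacing
-- some summands g j by e (g j) moves the sum into the principal ideal of Σ g; by
-- commutativity the order in which the two partial sums are added is irrelevant.
module Submission where

open import Defs
open import Level using (Level; _⊔_)
open import Algebra.Bundles using (CommutativeSemigroup)
open import Algebra.Definitions using (Congruent₂)
import Algebra.Properties.CommutativeSemigroup as CommutativeSemigroupProperties
open import Data.Bool using (if_then_else_)
open import Data.Nat using (ℕ; zero; suc)
open import Data.Fin using (Fin)
open import Data.Fin.Subset using (Subset)
open import Data.Fin.Subset.Properties using (_∈?_)
open import Data.List using ([]; _∷_; map; filter; allFin)
import Data.List.Relation.Binary.Pointwise as List
open import Data.Maybe using (Maybe; just; nothing)
open import Data.Maybe.Relation.Binary.Pointwise as Maybe using (Pointwise; just; nothing; drop-just)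
open import Data.Product using (_,_)
open import Data.Sum using (inj₁; inj₂)
open import Relation.Nullary using (does; yes; no; ¬?)
open import Relation.Unary using (Pred; Decidable)
open import Function using (_∘_)
open import Relation.Binary.PropositionalEquality as ≡ using (_≡_; subst₂)
import Relation.Binary.Reasoning.Setoid as SetoidReasoning

module PrincipalIdeal {c ℓ : Level} (S : CommutativeSemigroup c ℓ) where
  open CommutativeSemigroup S renaming (_∙_ to _+_)
  open SetoidReasoning setoid

  ≈⇒∈principal : ∀ {x y} → x ≈ y → _∈principal_ S x y
  ≈⇒∈principal = inj₁

  ∈principal-trans : ∀ {x y z} → _∈principal_ S x y → _∈principal_ S y z → _∈principal_ S x z
  ∈principal-trans (inj₁ x≈y) (inj₁ y≈z) = inj₁ (trans x≈y y≈z)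
  ∈principal-trans (inj₁ x≈y) (inj₂ (s , y≈z+s)) = inj₂ (s , trans x≈y y≈z+s)
  ∈principal-trans (inj₂ (r , x≈y+r)) (inj₁ y≈z) = inj₂ (r , trans x≈y+r (∙-congʳ y≈z))
  ∈principal-trans {x} {y} {z} (inj₂ (r , x≈y+r)) (inj₂ (s , y≈z+s)) = inj₂ (s + r , (begin
    x           ≈⟨ x≈y+r ⟩
    y + r       ≈⟨ ∙-congʳ y≈z+s ⟩
    (z + s) + r ≈⟨ assoc z s r ⟩
    z + (s + r) ∎))

  ∈principal⇒≼H : ∀ {a b} → _∈principal_ S a b → _≼H_ S a b
  ∈principal⇒≼H a∈b z z∈a = ∈principal-trans z∈a a∈b

  +-monoˡ-∈principal : ∀ {x y} w → _∈principal_ S x y → _∈principal_ S (w + x) (w + y)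
  +-monoˡ-∈principal w (inj₁ x≈y) = inj₁ (∙-congˡ x≈y)
  +-monoˡ-∈principal {x} {y} w (inj₂ (s , x≈y+s)) = inj₂ (s , (begin
    w + x       ≈⟨ ∙-congˡ x≈y+s ⟩
    w + (y + s) ≈⟨ assoc w y s ⟨
    (w + y) + s ∎))

  +-mono-∈principal : Congruent₂ (_∈principal_ S) _+_
  +-mono-∈principal {x} {y} {u} {v} x∈y u∈v = ∈principal-trans
    (+-monoˡ-∈principal x u∈v)
    (∈principal-trans (≈⇒∈principal (comm x v))
      (∈principal-trans (+-monoˡ-∈principal v x∈y) (≈⇒∈principal (comm v y))))

  mult+∈principal : ∀ m x y → _∈principal_ S (mult S m x + y) x
  mult+∈principal zero    x y = inj₂ (y , refl)
  mult+∈principal (suc m) x y = inj₂ (mult S m x + y , assoc x (mult S m x) y)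

  idempotent∈⟨⟩⇒∈principal : ∀ {x y} → IsIdempotent S y → _∈⟨_⟩ S y x → _∈principal_ S y x
  idempotent∈⟨⟩⇒∈principal {x} {y} y+y≈y (m , y≈mx) = ∈principal-trans
    (≈⇒∈principal (trans (sym y+y≈y) (∙-congʳ y≈mx)))
    (mult+∈principal m x y)

module PartialSums {c ℓ : Level} (S : CommutativeSemigroup c ℓ) where
  open CommutativeSemigroup S renaming (_∙_ to _+_)

  infixl 6 _⊕ˢ_
  _⊕ˢ_ : Maybe Carrier → Maybe Carrier → Maybe Carrier
  _⊕ˢ_ = _⊕_ S

  infix 4 _≋_
  _≋_ : Maybe Carrier → Maybe Carrier → Set (c ⊔ ℓ)
  _≋_ = Pointwise _≈_

  ⊕-congruent : ∀ {r} {R : Carrier → Carrier → Set r} → Congruent₂ R _+_ → Congruent₂ (Pointwise R) _⊕ˢ_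
  ⊕-congruent R-cong nothing  q        = q
  ⊕-congruent R-cong (just p) nothing  = just p
  ⊕-congruent R-cong (just p) (just q) = just (R-cong p q)

  ⊕-assoc : ∀ A B C → A ⊕ˢ B ⊕ˢ C ≋ A ⊕ˢ (B ⊕ˢ C)
  ⊕-assoc nothing  B        C        = Maybe.refl refl
  ⊕-assoc (just a) nothing  C        = Maybe.refl refl
  ⊕-assoc (just a) (just b) nothing  = Maybe.refl refl
  ⊕-assoc (just a) (just b) (just c) = just (assoc a b c)

  ⊕-comm : ∀ A B → A ⊕ˢ B ≋ B ⊕ˢ A
  ⊕-comm nothing  nothing  = nothing
  ⊕-comm nothing  (just b) = Maybe.refl refl
  ⊕-comm (just a) nothing  = Maybe.refl refl
  ⊕-comm (just a) (just b) = just (comm a b)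

  ⊕-commutativeSemigroup : CommutativeSemigroup c (c ⊔ ℓ)
  ⊕-commutativeSemigroup = record
    { Carrier = Maybe Carrier
    ; _≈_ = _≋_
    ; _∙_ = _⊕ˢ_
    ; isCommutativeSemigroup = record
      { isSemigroup = record
        { isMagma = record
          { isEquivalence = Maybe.isEquivalence isEquivalence
          ; ∙-cong = ⊕-congruent ∙-cong
          }
        ; assoc = ⊕-assoc
        }
      ; comm = ⊕-comm
      }
    }

  open CommutativeSemigroupProperties ⊕-commutativeSemigroup using (x∙yz≈y∙xz)
  open SetoidReasoning (CommutativeSemigroup.setoid ⊕-commutativeSemigroup)

  sum⁺-∷ : ∀ x xs → sum⁺ S (x ∷ xs) ≡ just x ⊕ˢ sum⁺ S xs
  sum⁺-∷ x xs with sum⁺ S xs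
  ... | nothing = ≡.refl
  ... | just s  = ≡.refl

  sum⁺-congruent : ∀ {r} {R : Carrier → Carrier → Set r} → Congruent₂ R _+_ →
                   ∀ {xs ys} → List.Pointwise R xs ys → Pointwise R (sum⁺ S xs) (sum⁺ S ys)
  sum⁺-congruent R-cong List.[] = nothing
  sum⁺-congruent R-cong {x ∷ xs} {y ∷ ys} (p List.∷ ps)
    rewrite sum⁺-∷ x xs | sum⁺-∷ y ys = ⊕-congruent R-cong (just p) (sum⁺-congruent R-cong ps)

  module _ {a p} {A : Set a} {P : Pred A p} (P? : Decidable P) (f g : A → Carrier) where

    choose : A → Carrier
    choose x = if does (P? x) then f x else g x

    sum⁺-partition : ∀ xs →
      sum⁺ S (map f (filter P? xs)) ⊕ˢ sum⁺ S (map g (filter (λ x → ¬? (P? x)) xs)) ≋ sum⁺ S (map choose xs)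
    sum⁺-partition [] = nothing
    sum⁺-partition (x ∷ xs) with P? x
    ... | yes _ = begin
      sum⁺ S (f x ∷ F) ⊕ˢ G                ≡⟨ ≡.cong (_⊕ˢ G) (sum⁺-∷ (f x) F) ⟩
      just (f x) ⊕ˢ sum⁺ S F ⊕ˢ G          ≈⟨ ⊕-assoc (just (f x)) (sum⁺ S F) G ⟩
      just (f x) ⊕ˢ (sum⁺ S F ⊕ˢ G)        ≈⟨ ⊕-congruent ∙-cong (just refl) (sum⁺-partition xs) ⟩
      just (f x) ⊕ˢ sum⁺ S (map choose xs) ≡⟨ sum⁺-∷ (f x) (map choose xs) ⟨
      sum⁺ S (f x ∷ map choose xs)         ∎
      where
      F = map f (filter P? xs)
      G = sum⁺ S (map g (filter (λ x → ¬? (P? x)) xs))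
    ... | no _ = begin
      F ⊕ˢ sum⁺ S (g x ∷ G)                ≡⟨ ≡.cong (F ⊕ˢ_) (sum⁺-∷ (g x) G) ⟩
      F ⊕ˢ (just (g x) ⊕ˢ sum⁺ S G)        ≈⟨ x∙yz≈y∙xz F (just (g x)) (sum⁺ S G) ⟩
      just (g x) ⊕ˢ (F ⊕ˢ sum⁺ S G)        ≈⟨ ⊕-congruent ∙-cong (just refl) (sum⁺-partition xs) ⟩
      just (g x) ⊕ˢ sum⁺ S (map choose xs) ≡⟨ sum⁺-∷ (g x) (map choose xs) ⟨
      sum⁺ S (g x ∷ map choose xs)         ∎
      where
      F = sum⁺ S (map f (filter P? xs))
      G = map g (filter (λ x → ¬? (P? x)) xs)

lemma3p16 : {c ℓ : Level} (S : CommutativeSemigroup c ℓ) → IsFinite S →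
    (e : CommutativeSemigroup.Carrier S → CommutativeSemigroup.Carrier S) → IsIdempotentMap S e →
    (t : ℕ) (g : Fin t → CommutativeSemigroup.Carrier S) (I : Subset t) →
    (a b : CommutativeSemigroup.Carrier S) →
    _⊕_ S (sumOver S I g) (sumOverCompl S I (λ j → e (g j))) ≡ just a →
    sumAll S g ≡ just b →
    _≼H_ S a b
-- Finiteness only guarantees that the idempotent map exists; here e is given.
lemma3p16 S _ e e-idempotent t g I a b sum≡a sum≡b =
  ∈principal⇒≼H (drop-just (subst₂ (Pointwise (_∈principal_ S)) sum≡a sum≡b
    (Maybe.trans (λ x≈y → ∈principal-trans (≈⇒∈principal x≈y)) regroup sum-mixed∈principal-sum-g)))
  where
  open CommutativeSemigroup S using (Carrier; refl)
  open PrincipalIdeal S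
  open PartialSums S

  mixed : Fin t → Carrier
  mixed = choose (_∈? I) g (e ∘ g)

  mixed∈principal-g : ∀ j → _∈principal_ S (mixed j) (g j)
  mixed∈principal-g j with j ∈? I
  ... | yes _ = ≈⇒∈principal refl
  ... | no  _ = let (idempotent , ∈⟨g⟩) = e-idempotent (g j) in idempotent∈⟨⟩⇒∈principal idempotent ∈⟨g⟩

  regroup : _⊕_ S (sumOver S I g) (sumOverCompl S I (e ∘ g)) ≋ sum⁺ S (map mixed (allFin t))
  regroup = sum⁺-partition (_∈? I) g (e ∘ g) (allFin t)

  sum-mixed∈principal-sum-g : Pointwise (_∈principal_ S) (sum⁺ S (map mixed (allFin t))) (sumAll S g)
  sum-mixed∈principal-sum-g = sum⁺-congruent +-mono-∈principal
    (List.map⁺ mixed g (List.refl (λ {j} → mixed∈principal-g j) {allFin t}))
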